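{- Let $G$ be a connected, triangle-free graph of order $n$ and minimum degree $\delta$, let $u$ be a vertex of $G$, and let $X(u)=(n_0,n_1,\ldots,n_d)$ be the distance degree of $u$. Then: (A1) $n_0=1$; (A2) $\sum_{i=0}^{\infty} n_i=n$; (A3) if $i\ge 1$ and $n_i\ge 1$, then $n_1,n_2,\ldots,n_{i-1}\ge 1$; (A4) if $i\ge 0$ and $n_i\ge 1$ and $n_{i+1}\ge 1$, then $n_{i-1}+n_i+n_{i+1}+n_{i+2}\ge 2\delta$; (A5) if $i\ge 0$ and $n_i>0$, then $n_{i-1}+n_i+n_{i+1}\ge \delta+1$; (A6) if $n_{d-1}\le \delta-1$, then $n_{d-1}+n_d\ge 2\delta$.
   Context: For a vertex $v$ of a connected graph, $d(v,w)$ is the shortest-path distance, the eccentricity of $v$ is $\max_w d(v,w)$, and if $d$ is the eccentricity of $v$ then the distance degree of $v$ is the sequence $X(v)=(n_0,n_1,\ldots,n_d)$ where $n_i$ is the number of vertices at distance exactly $i$ from $v$. By convention $n_i=0$ for all integers $i<0$ or $i>d$. Triangle-free means containing no $K_3$ as a subgraph. -}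

module Defs where

open import Data.Nat using (ℕ; zero; suc; _+_; _⊔_; _≤_)
open import Data.Bool using (Bool; true; false; _∧_; _∨_; if_then_else_; T)
open import Data.Fin using (Fin)
open import Data.Fin.Properties using (_≟_)
open import Data.List using (List; map; filter; length; upTo)
open import Data.Nat.ListAction using (sum)
open import Data.Bool.ListAction using (any)
open import Data.List.Base using (foldr)
open import Data.Vec using (allFin; toList)
open import Data.Product using (∃; _×_)
open import Relation.Nullary using (¬_; does)
open import Relation.Binary.PropositionalEquality using (_≡_)
import Data.Nat as ℕ

vertices : (n : ℕ) → List (Fin n)
vertices n = toList (allFin n)

record Graph (n : ℕ) : Set where
  field
    adj   : Fin n → Fin n → Bool
    irrefl : ∀ x → adj x x ≡ false
    sym   : ∀ x y → adj x y ≡ adj y x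

module _ {n : ℕ} (G : Graph n) where
  open Graph G

  within : ℕ → Fin n → Fin n → Bool
  within zero    u w = does (u ≟ w)
  within (suc k) u w = within k u w ∨ any (λ x → within k u x ∧ adj x w) (vertices n)

  Connected : Set
  Connected = ∀ u w → ∃ λ k → T (within k u w)

  TriangleFree : Set
  TriangleFree = ∀ x y z → ¬ (T (adj x y) × T (adj y z) × T (adj x z))

  deg : Fin n → ℕ
  deg v = length (filter (λ w → T? (adj v w)) (vertices n))
    where
    open import Data.Bool.Properties using () renaming (T? to T?)

  IsMinDegree : ℕ → Set
  IsMinDegree δ = (∀ v → δ ≤ deg v) × ∃ λ v → deg v ≡ δ

  -- shortest-path distance: least k with a walk of length ≤ k (searched
  -- among 0 … n; correct for connected graphs, where d(u,w) ≤ n - 1).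
  distFrom : ℕ → ℕ → Fin n → Fin n → ℕ
  distFrom k zero    u w = k
  distFrom k (suc f) u w = if within k u w then k else distFrom (suc k) f u w

  dist : Fin n → Fin n → ℕ
  dist u w = distFrom 0 n u w

  ecc : Fin n → ℕ
  ecc u = foldr (λ w m → dist u w ⊔ m) 0 (vertices n)

  nd : Fin n → ℕ → ℕ
  nd u i = length (filter (λ w → dist u w ℕ.≟ i) (vertices n))

  ndPrev : Fin n → ℕ → ℕ
  ndPrev u zero    = 0
  ndPrev u (suc i) = nd u i

  ndSum : Fin n → ℕ → ℕ
  ndSum u m = sum (map (nd u) (upTo m))

-- Along an edge the distance
-- from u changes by at most one, so the closed neighbourhood of a vertex on
-- level i lies on levels i - 1, i, i + 1, which gives (A5); and no walk from u
-- can jump over an empty level, so in a connected graph the levels have no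
-- gaps (A3).  In a triangle-free graph adjacent vertices have disjoint
-- neighbourhoods: an edge between levels i and i + 1 puts 2δ vertices on levels
-- i - 1, ..., i + 2 (A4), and an edge inside the last level d puts 2δ vertices
-- on levels d - 1, d (A6).
module Submission where

open import Defs
open import Data.Bool using (T; true; false; _∧_)
open import Data.Bool.Properties using (T-∨; T-∧; T?)
open import Data.Empty using (⊥-elim)
open import Data.Fin using (Fin; zero; suc; toℕ)
open import Data.Fin.Properties using (_≟_; any?; toℕ≤pred[n]; toℕ<n; pigeonhole)
  renaming (suc-injective to Fin-suc-injective)
open import Data.List using ([]; _∷_; filter; length; map; foldr; upTo; _++_; [_])
open import Data.List.Membership.Propositional using (_∈_; lose)
open import Data.List.Properties using (filter-none; filter-all; filter-some; filter-≐; upTo-∷ʳ; map-++)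
open import Data.List.Relation.Unary.Any using (here; there; satisfied)
open import Data.List.Relation.Unary.Any.Properties using (any⁺; any⁻)
import Data.List.Relation.Unary.All as All
open import Data.Nat using (ℕ; zero; suc; _+_; _*_; _⊔_; _≤_; _<_; z≤n; s≤s)
  renaming (_≟_ to _≟ℕ_)
open import Data.Nat.ListAction using (sum)
open import Data.Nat.ListAction.Properties using (sum-++)
open import Data.Nat.Properties hiding (_≟_)
open import Data.Product using (∃; _×_; _,_; proj₁; proj₂)
open import Data.Sum using (_⊎_; inj₁; inj₂)
open import Data.Unit using (tt)
open import Data.Vec using (allFin; toList)
open import Data.Vec.Membership.Propositional.Properties using (∈-allFin⁺; ∈-toList⁺)
open import Data.Vec.Properties using (allFin-map; toList-map; length-toList)
open import Function using (_∘_; Equivalence)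
open import Level using (0ℓ)
open import Relation.Nullary using (yes; no; contradiction; _×-dec_)
open import Relation.Unary using (Pred; Decidable; _⊆_; _⊥_; _≐_)
open import Relation.Unary.Properties using (_∪?_; _∩?_)
open import Relation.Binary.PropositionalEquality hiding ([_])

module _ {a p q} {A : Set a} {P : Pred A p} {Q : Pred A q}
         (P? : Decidable P) (Q? : Decidable Q) where

  length-filter-⊆ : P ⊆ Q → ∀ xs → length (filter P? xs) ≤ length (filter Q? xs)
  length-filter-⊆ P⊆Q [] = z≤n
  length-filter-⊆ P⊆Q (x ∷ xs) with P? x | Q? x
  ... | yes _  | yes _  = s≤s (length-filter-⊆ P⊆Q xs)
  ... | yes px | no ¬qx = contradiction (P⊆Q px) ¬qx
  ... | no _   | yes _  = m≤n⇒m≤1+n (length-filter-⊆ P⊆Q xs)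
  ... | no _   | no _   = length-filter-⊆ P⊆Q xs

  length-filter-≐ : P ≐ Q → ∀ xs → length (filter P? xs) ≡ length (filter Q? xs)
  length-filter-≐ P≐Q = cong length ∘ filter-≐ P? Q? P≐Q

  length-filter-∪-∩ : ∀ xs →
    length (filter (P? ∪? Q?) xs) + length (filter (P? ∩? Q?) xs)
      ≡ length (filter P? xs) + length (filter Q? xs)
  length-filter-∪-∩ [] = refl
  length-filter-∪-∩ (x ∷ xs) with ih ← length-filter-∪-∩ xs | P? x | Q? x
  ... | yes _ | yes _ = cong suc (trans (+-suc _ _) (trans (cong suc ih) (sym (+-suc _ _))))
  ... | yes _ | no _  = cong suc ih
  ... | no _  | yes _ = trans (cong suc ih) (sym (+-suc _ _))
  ... | no _  | no _  = ih

  length-filter-∪ : ∀ xs →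
    length (filter (P? ∪? Q?) xs) ≤ length (filter P? xs) + length (filter Q? xs)
  length-filter-∪ xs = ≤-trans (m≤m+n _ _) (≤-reflexive (length-filter-∪-∩ xs))

  length-filter-disjoint : P ⊥ Q → ∀ xs →
    length (filter P? xs) + length (filter Q? xs) ≡ length (filter (P? ∪? Q?) xs)
  length-filter-disjoint P⊥Q xs = begin
    length (filter P? xs) + length (filter Q? xs)                  ≡⟨ length-filter-∪-∩ xs ⟨
    length (filter (P? ∪? Q?) xs) + length (filter (P? ∩? Q?) xs)  ≡⟨ cong ((length (filter (P? ∪? Q?) xs) +_) ∘ length)
                                                                         (filter-none (P? ∩? Q?) (All.universal (λ _ → P⊥Q) xs)) ⟩
    length (filter (P? ∪? Q?) xs) + 0                               ≡⟨ +-identityʳ _ ⟩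
    length (filter (P? ∪? Q?) xs)                                   ∎
    where open ≡-Reasoning

module _ {a p q r} {A : Set a} {P : Pred A p} {Q : Pred A q} {R : Pred A r}
         (P? : Decidable P) (Q? : Decidable Q) (R? : Decidable R) where

  length-filter-disjoint-⊆ : P ⊥ Q → (∀ {x} → P x ⊎ Q x → R x) → ∀ xs →
    length (filter P? xs) + length (filter Q? xs) ≤ length (filter R? xs)
  length-filter-disjoint-⊆ P⊥Q P∪Q⊆R xs =
    ≤-trans (≤-reflexive (length-filter-disjoint P? Q? P⊥Q xs)) (length-filter-⊆ (P? ∪? Q?) R? P∪Q⊆R xs)

module _ {a b p} {A : Set a} {B : Set b} {P : Pred B p} (P? : Decidable P) where

  length-filter-map : ∀ (f : A → B) xs → length (filter P? (map f xs)) ≡ length (filter (P? ∘ f) xs)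
  length-filter-map f [] = refl
  length-filter-map f (x ∷ xs) with P? (f x)
  ... | yes _ = cong suc (length-filter-map f xs)
  ... | no _  = length-filter-map f xs

module _ {a} {A : Set a} (f : A → ℕ) where

  foldr-⊔-upper : ∀ {x xs} → x ∈ xs → f x ≤ foldr (λ y m → f y ⊔ m) 0 xs
  foldr-⊔-upper {xs = y ∷ xs} (here refl) = m≤m⊔n (f y) _
  foldr-⊔-upper {xs = y ∷ xs} (there x∈xs) = ≤-trans (foldr-⊔-upper x∈xs) (m≤n⊔m (f y) _)

  foldr-⊔-attained : ∀ xs → let m = foldr (λ y m → f y ⊔ m) 0 xs in m ≡ 0 ⊎ ∃ λ x → f x ≡ m
  foldr-⊔-attained [] = inj₁ refl
  foldr-⊔-attained (y ∷ xs) with ⊔-sel (f y) (foldr (λ y m → f y ⊔ m) 0 xs) | foldr-⊔-attained xs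
  ... | inj₁ fy⊔m≡fy | _               = inj₂ (y , sym fy⊔m≡fy)
  ... | inj₂ fy⊔m≡m  | inj₁ m≡0        = inj₁ (trans fy⊔m≡m m≡0)
  ... | inj₂ fy⊔m≡m  | inj₂ (x , fx≡m) = inj₂ (x , trans fx≡m (sym fy⊔m≡m))

2*m≤n+o : ∀ {m n o} → m ≤ n → m ≤ o → 2 * m ≤ n + o
2*m≤n+o {m} m≤n m≤o = +-mono-≤ m≤n (subst (_≤ _) (sym (+-identityʳ m)) m≤o)

∈-vertices : ∀ {n} (x : Fin n) → x ∈ vertices n
∈-vertices x = ∈-toList⁺ (∈-allFin⁺ x)

length-vertices : ∀ n → length (vertices n) ≡ n
length-vertices n = length-toList (allFin n)

vertices-suc : ∀ n → vertices (suc n) ≡ zero ∷ map suc (vertices n)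
vertices-suc n = trans (cong toList (allFin-map n)) (cong (zero ∷_) (toList-map suc (allFin n)))

length-filter-≡-vertices : ∀ {n} (u : Fin n) → length (filter (u ≟_) (vertices n)) ≡ 1
length-filter-≡-vertices {suc n} u =
  trans (cong (length ∘ filter (u ≟_)) (vertices-suc n)) (count-split u)
  where
  open ≡-Reasoning
  count-split : ∀ u → length (filter (u ≟_) (zero ∷ map suc (vertices n))) ≡ 1
  count-split zero    = cong suc (trans (length-filter-map (zero ≟_) suc (vertices n))
                                        (cong length (filter-none _ (All.universal (λ _ ()) (vertices n)))))
  count-split (suc v) = begin
    length (filter (suc v ≟_) (map suc (vertices n)))  ≡⟨ length-filter-map (suc v ≟_) suc (vertices n) ⟩
    length (filter ((suc v ≟_) ∘ suc) (vertices n))    ≡⟨ length-filter-≐ _ (v ≟_) (Fin-suc-injective , cong suc) (vertices n) ⟩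
    length (filter (v ≟_) (vertices n))                ≡⟨ length-filter-≡-vertices v ⟩
    1                                                  ∎

count : ∀ {n p} {P : Pred (Fin n) p} → Decidable P → ℕ
count {n} P? = length (filter P? (vertices n))

module _ {n p} {P : Pred (Fin n) p} (P? : Decidable P) where

  count-positive : ∀ {x} → P x → 1 ≤ count P?
  count-positive {x} px = filter-some P? (lose (∈-vertices x) px)

  count-positive⇒∃ : 1 ≤ count P? → ∃ P
  count-positive⇒∃ h with any? P?
  ... | yes ∃P = ∃P
  ... | no  ∄P with () ← subst (1 ≤_) (cong length (filter-none P? (All.universal (λ x px → ∄P (x , px)) (vertices n)))) h

module _ {n : ℕ} (G : Graph n) where
  open Graph G renaming (sym to adj-sym)

  Adjacent : Fin n → Pred (Fin n) 0ℓ
  Adjacent x w = T (adj x w)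

  adjacent? : ∀ x → Decidable (Adjacent x)
  adjacent? x w = T? (adj x w)

  adjacent-sym : ∀ {x y} → T (adj x y) → T (adj y x)
  adjacent-sym {x} {y} = subst T (adj-sym x y)

  triangleFree⇒neighbourhoods-disjoint : TriangleFree G → ∀ {x y} → T (adj x y) → Adjacent x ⊥ Adjacent y
  triangleFree⇒neighbourhoods-disjoint tf {x} {y} xy {w} (xw , yw) = tf x y w (xy , yw , xw)

  within-zero : ∀ u w → T (within G 0 u w) → u ≡ w
  within-zero u w with u ≟ w
  ... | yes u≡w = λ _ → u≡w
  ... | no _    = λ ()

  within-refl : ∀ u → T (within G 0 u u)
  within-refl u with u ≟ u
  ... | yes _   = tt
  ... | no u≢u  = u≢u refl

  within-step : ∀ k u x w → T (within G k u x) → T (adj x w) → T (within G (suc k) u w)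
  within-step k u x w ux xw = Equivalence.from T-∨ (inj₂
    (any⁺ (λ y → within G k u y ∧ adj y w) (lose (∈-vertices x) (Equivalence.from T-∧ (ux , xw)))))

  within-suc⁻ : ∀ k u w → T (within G (suc k) u w) →
                T (within G k u w) ⊎ ∃ λ x → T (within G k u x) × T (adj x w)
  within-suc⁻ k u w h with Equivalence.to T-∨ h
  ... | inj₁ uw  = inj₁ uw
  ... | inj₂ via with x , ux∧xw ← satisfied (any⁻ (λ y → within G k u y ∧ adj y w) (vertices n) via)
    = inj₂ (x , Equivalence.to T-∧ ux∧xw)

  module _ (u : Fin n) {w : Fin n} where

    distFrom-≤ : ∀ k f → distFrom G k f u w ≤ k + f
    distFrom-≤ k zero = m≤m+n k 0
    distFrom-≤ k (suc f) with within G k u w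
    ... | true  = m≤m+n k (suc f)
    ... | false = ≤-trans (distFrom-≤ (suc k) f) (≤-reflexive (sym (+-suc k f)))

    distFrom-minimal : ∀ k f {m} → k ≤ m → T (within G m u w) → distFrom G k f u w ≤ m
    distFrom-minimal k zero    k≤m _ = k≤m
    distFrom-minimal k (suc f) {m} k≤m h with within G k u w in eq
    ... | true  = k≤m
    ... | false = distFrom-minimal (suc k) f (≤∧≢⇒< k≤m k≢m) h
      where
      k≢m : k ≢ m
      k≢m refl = subst T eq h

    distFrom-attained : ∀ k f → distFrom G k f u w < k + f → T (within G (distFrom G k f u w) u w)
    distFrom-attained k zero    lt = ⊥-elim (<-irrefl (sym (+-identityʳ k)) lt)
    distFrom-attained k (suc f) lt with within G k u w in eq
    ... | true  = subst T (sym eq) tt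
    ... | false = distFrom-attained (suc k) f (≤-trans lt (≤-reflexive (+-suc k f)))

  module _ (u : Fin n) where

    dist-≤ : ∀ {w} → dist G u w ≤ n
    dist-≤ = distFrom-≤ u 0 n

    dist-minimal : ∀ m w → T (within G m u w) → dist G u w ≤ m
    dist-minimal m w = distFrom-minimal u 0 n z≤n

    dist-attained-below : ∀ w → dist G u w < n → T (within G (dist G u w) u w)
    dist-attained-below w = distFrom-attained u 0 n

    dist-self : dist G u u ≡ 0
    dist-self = n≤0⇒n≡0 (dist-minimal 0 u (within-refl u))

    dist≡0⇒≡ : ∀ {w} → dist G u w ≡ 0 → u ≡ w
    dist≡0⇒≡ {w} d≡0 = within-zero u w (subst (λ k → T (within G k u w)) d≡0
      (dist-attained-below w (subst (_< n) (sym d≡0) (≤-trans (s≤s z≤n) (toℕ<n u)))))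

    dist-adjacent : ∀ {x y} → T (adj x y) → dist G u y ≤ suc (dist G u x)
    dist-adjacent {x} {y} xy with dist G u x <? n
    ... | yes lt  = dist-minimal _ y (within-step (dist G u x) u x y (dist-attained-below x lt) xy)
    ... | no ¬lt  = ≤-trans dist-≤ (m≤n⇒m≤1+n (≮⇒≥ ¬lt))

    dist-gap : ∀ {i} → (∀ v → dist G u v ≢ suc i) → ∀ m w → T (within G m u w) → dist G u w ≤ i
    dist-gap gap zero    w h = ≤-trans (dist-minimal 0 w h) z≤n
    dist-gap gap (suc m) w h with within-suc⁻ m u w h
    ... | inj₁ uw            = dist-gap gap m w uw
    ... | inj₂ (x , ux , xw) =
      ≤-pred (≤∧≢⇒< (≤-trans (dist-adjacent xw) (s≤s (dist-gap gap m x ux))) (gap w))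

    dist-≤-ecc : ∀ w → dist G u w ≤ ecc G u
    dist-≤-ecc w = foldr-⊔-upper (dist G u) (∈-vertices w)

    ecc-attained : ∃ λ w → dist G u w ≡ ecc G u
    ecc-attained with foldr-⊔-attained (dist G u) (vertices n)
    ... | inj₁ ecc≡0 = u , trans dist-self (sym ecc≡0)
    ... | inj₂ far   = far

    level? : ∀ j → Decidable (λ w → dist G u w ≡ j)
    level? j w = dist G u w ≟ℕ j

    nd-zero : nd G u 0 ≡ 1
    nd-zero = trans (length-filter-≐ _ (u ≟_) (dist≡0⇒≡ , λ { refl → dist-self }) (vertices n))
                    (length-filter-≡-vertices u)

    ndSum≡count : ∀ m → ndSum G u m ≡ count (λ w → dist G u w <? m)
    ndSum≡count zero    = sym (cong length (filter-none _ (All.universal (λ _ ()) (vertices n))))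
    ndSum≡count (suc m) = begin
      sum (map (nd G u) (upTo (suc m)))                             ≡⟨ cong (sum ∘ map (nd G u)) (upTo-∷ʳ m) ⟨
      sum (map (nd G u) (upTo m ++ [ m ]))                          ≡⟨ cong sum (map-++ (nd G u) (upTo m) [ m ]) ⟩
      sum (map (nd G u) (upTo m) ++ [ nd G u m ])                   ≡⟨ sum-++ (map (nd G u) (upTo m)) [ nd G u m ] ⟩
      ndSum G u m + (nd G u m + 0)                                  ≡⟨ cong₂ _+_ (ndSum≡count m) (+-identityʳ _) ⟩
      count below + count (level? m)                                ≡⟨ length-filter-disjoint below (level? m) disjoint (vertices n) ⟩
      count (below ∪? level? m)                                     ≡⟨ length-filter-≐ _ _ (to , from) (vertices n) ⟩
      count (λ w → dist G u w <? suc m)                             ∎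
      where
      open ≡-Reasoning
      below : Decidable (λ w → dist G u w < m)
      below w = dist G u w <? m
      disjoint : (λ w → dist G u w < m) ⊥ (λ w → dist G u w ≡ m)
      disjoint (d<m , d≡m) = <-irrefl d≡m d<m
      to : ∀ {w} → dist G u w < m ⊎ dist G u w ≡ m → dist G u w < suc m
      to (inj₁ d<m) = m<n⇒m<1+n d<m
      to (inj₂ d≡m) = s≤s (≤-reflexive d≡m)
      from : ∀ {w} → dist G u w < suc m → dist G u w < m ⊎ dist G u w ≡ m
      from = m≤n⇒m<n∨m≡n ∘ ≤-pred

    sum-nd : ndSum G u (suc (ecc G u)) ≡ n
    sum-nd = trans (ndSum≡count (suc (ecc G u)))
      (trans (cong length (filter-all _ (All.universal (s≤s ∘ dist-≤-ecc) (vertices n)))) (length-vertices n))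

    -- window i k = n_{i-1} + n_i + ⋯ + n_{i+k-1} (k + 1 levels, summed from the left);
    -- level j is counted through the shifted distance suc (dist G u w) = j + 1.
    window : ℕ → ℕ → ℕ
    window i zero    = ndPrev G u i
    window i (suc k) = window i k + nd G u (k + i)

    InWindow : ℕ → ℕ → Pred (Fin n) 0ℓ
    InWindow i k w = i ≤ suc (dist G u w) × suc (dist G u w) ≤ k + i

    inWindow? : ∀ i k → Decidable (InWindow i k)
    inWindow? i k w = (i ≤? suc (dist G u w)) ×-dec (suc (dist G u w) ≤? k + i)

    count-shiftedLevel : ∀ i → count (λ w → suc (dist G u w) ≟ℕ i) ≡ ndPrev G u i
    count-shiftedLevel zero    = cong length (filter-none _ (All.universal (λ _ ()) (vertices n)))
    count-shiftedLevel (suc i) = length-filter-≐ _ _ (suc-injective , cong suc) (vertices n)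

    count-window : ∀ i k → count (inWindow? i k) ≤ window i k
    count-window i zero = ≤-trans
      (length-filter-⊆ (inWindow? i 0) (λ w → suc (dist G u w) ≟ℕ i) (λ (lo , hi) → ≤-antisym hi lo) (vertices n))
      (≤-reflexive (count-shiftedLevel i))
    count-window i (suc k) = begin
      count (inWindow? i (suc k))                 ≤⟨ length-filter-⊆ _ (inWindow? i k ∪? level? (k + i)) split (vertices n) ⟩
      count (inWindow? i k ∪? level? (k + i))     ≤⟨ length-filter-∪ (inWindow? i k) (level? (k + i)) (vertices n) ⟩
      count (inWindow? i k) + nd G u (k + i)      ≤⟨ +-monoˡ-≤ (nd G u (k + i)) (count-window i k) ⟩
      window i (suc k)                            ∎
      where
      open ≤-Reasoning
      split : InWindow i (suc k) ⊆ λ w → InWindow i k w ⊎ dist G u w ≡ k + i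
      split (lo , hi) with m≤n⇒m<n∨m≡n hi
      ... | inj₁ below = inj₁ (lo , ≤-pred below)
      ... | inj₂ at    = inj₂ (suc-injective at)

    InWindow-mono : ∀ {i k i′ k′} → i′ ≤ i → k + i ≤ k′ + i′ → InWindow i k ⊆ InWindow i′ k′
    InWindow-mono i′≤i top≤top′ (lo , hi) = ≤-trans i′≤i lo , ≤-trans hi top≤top′

    self-inWindow : ∀ {x i} → dist G u x ≡ i → InWindow i 2 x
    self-inWindow refl = n≤1+n _ , s≤s (n≤1+n _)

    neighbour-inWindow : ∀ {x w i} → dist G u x ≡ i → T (adj x w) → InWindow i 2 w
    neighbour-inWindow refl xw = dist-adjacent (adjacent-sym xw) , s≤s (dist-adjacent xw)

    ecc-neighbour-inWindow : ∀ {x w} → dist G u x ≡ ecc G u → T (adj x w) → InWindow (ecc G u) 1 w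
    ecc-neighbour-inWindow {w = w} dx xw = proj₁ (neighbour-inWindow dx xw) , s≤s (dist-≤-ecc w)

    module _ {δ} (δ≤deg : ∀ v → δ ≤ deg G v) where

      δ<window₂ : ∀ {i} → 1 ≤ nd G u i → δ < window i 2
      δ<window₂ {i} h with x , dx ← count-positive⇒∃ _ h = begin-strict
        δ                          <⟨ s≤s (δ≤deg x) ⟩
        1 + deg G x                ≤⟨ +-monoˡ-≤ (deg G x) (count-positive (x ≟_) refl) ⟩
        count (x ≟_) + deg G x     ≤⟨ length-filter-disjoint-⊆ (x ≟_) (adjacent? x) (inWindow? i 2)
                                        loopless closedNeighbourhood (vertices n) ⟩
        count (inWindow? i 2)      ≤⟨ count-window i 2 ⟩
        window i 2                 ∎
        where
        open ≤-Reasoning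
        loopless : (x ≡_) ⊥ Adjacent x
        loopless (refl , xx) = subst T (irrefl x) xx
        closedNeighbourhood : ∀ {w} → x ≡ w ⊎ T (adj x w) → InWindow i 2 w
        closedNeighbourhood (inj₁ refl) = self-inWindow dx
        closedNeighbourhood (inj₂ xw)   = neighbour-inWindow dx xw

      -- If the far vertex y had no neighbour on the last level, all its
      -- neighbours would lie on level ecc - 1, which has fewer than δ vertices.
      2δ≤window₁-at-ecc : TriangleFree G → ndPrev G u (ecc G u) < δ → 2 * δ ≤ window (ecc G u) 1
      2δ≤window₁-at-ecc tf prev<δ with y , dy ← ecc-attained
                                  with any? (λ z → adjacent? y z ×-dec level? (ecc G u) z)
      ... | no ∄z = contradiction (begin
        δ                              ≤⟨ δ≤deg y ⟩
        deg G y                        ≤⟨ length-filter-⊆ (adjacent? y) (inWindow? (ecc G u) 0) downward (vertices n) ⟩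
        count (inWindow? (ecc G u) 0)  ≤⟨ count-window (ecc G u) 0 ⟩
        ndPrev G u (ecc G u)           ∎) (<⇒≱ prev<δ)
        where
        open ≤-Reasoning
        downward : Adjacent y ⊆ InWindow (ecc G u) 0
        downward {w} yw = proj₁ (neighbour-inWindow dy yw) , ≤∧≢⇒< (dist-≤-ecc w) (λ dw → ∄z (w , yw , dw))
      ... | yes (z , yz , dz) = begin
        2 * δ                          ≤⟨ 2*m≤n+o (δ≤deg y) (δ≤deg z) ⟩
        deg G y + deg G z              ≤⟨ length-filter-disjoint-⊆ (adjacent? y) (adjacent? z) (inWindow? (ecc G u) 1)
                                            (triangleFree⇒neighbourhoods-disjoint tf yz) neighbourhoods (vertices n) ⟩
        count (inWindow? (ecc G u) 1)  ≤⟨ count-window (ecc G u) 1 ⟩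
        window (ecc G u) 1             ∎
        where
        open ≤-Reasoning
        neighbourhoods : ∀ {w} → T (adj y w) ⊎ T (adj z w) → InWindow (ecc G u) 1 w
        neighbourhoods (inj₁ yw) = ecc-neighbour-inWindow dy yw
        neighbourhoods (inj₂ zw) = ecc-neighbour-inWindow dz zw

  module _ (connected : Connected G) (u : Fin n) where

    dist-gap-free : ∀ {j} w → j ≤ dist G u w → ∃ λ v → dist G u v ≡ j
    dist-gap-free {zero}  w _ = u , dist-self u
    dist-gap-free {suc i} w j≤d with any? (level? u (suc i))
    ... | yes level-nonempty = level-nonempty
    ... | no  level-empty with k , walk ← connected u w =
      contradiction (≤-trans j≤d (dist-gap u gap k w walk)) 1+n≰n
      where
      gap : ∀ v → dist G u v ≢ suc i
      gap v d≡ = level-empty (v , d≡)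

    vertex-at-level : ∀ w → n ≤ dist G u w → (j : Fin (suc n)) → ∃ λ v → dist G u v ≡ toℕ j
    vertex-at-level w n≤d j = dist-gap-free w (≤-trans (toℕ≤pred[n] j) n≤d)

    -- dist caps its search at n, so this rules out the cap being hit: a
    -- vertex at distance n would need n + 1 distinct vertices on its levels.
    dist<n : ∀ w → dist G u w < n
    dist<n w with dist G u w <? n
    ... | yes d<n = d<n
    ... | no  d≮n with vertex-at-level w (≮⇒≥ d≮n)
    ...   | vertex with pigeonhole (n<1+n n) (proj₁ ∘ vertex)
    ...     | i , j , i<j , same =
      contradiction (trans (sym (proj₂ (vertex i))) (trans (cong (dist G u) same) (proj₂ (vertex j)))) (<⇒≢ i<j)

    dist-attained : ∀ w → T (within G (dist G u w) u w)
    dist-attained w = dist-attained-below u w (dist<n w)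

    dist-predecessor : ∀ {w i} → dist G u w ≡ suc i → ∃ λ x → T (adj x w) × dist G u x ≡ i
    dist-predecessor {w} {i} d≡ with within-suc⁻ i u w (subst (λ k → T (within G k u w)) d≡ (dist-attained w))
    ... | inj₁ uw = contradiction (subst (_≤ i) d≡ (dist-minimal u i w uw)) 1+n≰n
    ... | inj₂ (x , ux , xw) =
      x , xw , ≤-antisym (dist-minimal u i x ux) (≤-pred (subst (_≤ suc (dist G u x)) d≡ (dist-adjacent u xw)))

    nd-downward-closed : ∀ {i j} → 1 ≤ nd G u i → j ≤ i → 1 ≤ nd G u j
    nd-downward-closed {j = j} h j≤i with w , dw ← count-positive⇒∃ _ h =
      count-positive (level? u j) (proj₂ (dist-gap-free w (subst (j ≤_) (sym dw) j≤i)))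

    module _ {δ} (δ≤deg : ∀ v → δ ≤ deg G v) where

      2δ≤window₃ : TriangleFree G → ∀ {i} → 1 ≤ nd G u (suc i) → 2 * δ ≤ window u i 3
      2δ≤window₃ tf {i} h with y , dy ← count-positive⇒∃ _ h
                          with x , xy , dx ← dist-predecessor dy = begin
        2 * δ                    ≤⟨ 2*m≤n+o (δ≤deg x) (δ≤deg y) ⟩
        deg G x + deg G y        ≤⟨ length-filter-disjoint-⊆ (adjacent? x) (adjacent? y) (inWindow? u i 3)
                                      (triangleFree⇒neighbourhoods-disjoint tf xy) neighbourhoods (vertices n) ⟩
        count (inWindow? u i 3)  ≤⟨ count-window u i 3 ⟩
        window u i 3             ∎
        where
        open ≤-Reasoning
        neighbourhoods : ∀ {w} → T (adj x w) ⊎ T (adj y w) → InWindow u i 3 w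
        neighbourhoods (inj₁ xw) = InWindow-mono u ≤-refl (n≤1+n _) (neighbour-inWindow u dx xw)
        neighbourhoods (inj₂ yw) = InWindow-mono u {k = 2} (n≤1+n i) ≤-refl (neighbour-inWindow u dy yw)

proposition3p1 : (n : ℕ) (G : Graph n) → Connected G → TriangleFree G →
      (δ : ℕ) → IsMinDegree G δ → (u : Fin n) →
      (nd G u 0 ≡ 1)
      × (ndSum G u (suc (ecc G u)) ≡ n)
      × (∀ i → 1 ≤ i → 1 ≤ nd G u i → ∀ j → 1 ≤ j → j < i → 1 ≤ nd G u j)
      × (∀ i → 1 ≤ nd G u i → 1 ≤ nd G u (suc i) →
           2 * δ ≤ ndPrev G u i + nd G u i + nd G u (suc i) + nd G u (suc (suc i)))
      × (∀ i → 1 ≤ nd G u i → suc δ ≤ ndPrev G u i + nd G u i + nd G u (suc i))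
      × (suc (ndPrev G u (ecc G u)) ≤ δ →
           2 * δ ≤ ndPrev G u (ecc G u) + nd G u (ecc G u))
proposition3p1 n G connected triangleFree δ (δ≤deg , _) u =
    nd-zero G u
  , sum-nd G u
  , (λ i _ nᵢ>0 j _ j<i → nd-downward-closed G connected u nᵢ>0 (<⇒≤ j<i))
  , (λ i _ nᵢ₊₁>0 → 2δ≤window₃ G connected u δ≤deg triangleFree nᵢ₊₁>0)
  , (λ i nᵢ>0 → δ<window₂ G u δ≤deg nᵢ>0)
  , 2δ≤window₁-at-ecc G u δ≤deg triangleFree
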